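{- Let $g(x)$ and $h(x)$ be monic polynomials in $\mathbb{Z}[x]$, with $h(x)$ having nonzero discriminant. Assume that for infinitely many primes $p$ such that $h(x) \bmod p$ splits completely (into linear factors) in $\mathbb{F}_{p}[x]$, the following holds: for every $k \in \mathbb{Z}$ with $h(k) \equiv 0 \pmod{p}$ we have $g(k) \equiv 0 \pmod{p}$. Then $h(x)$ divides $g(x)$ in $\mathbb{Z}[x]$. -}

module Defs where

open import Data.Nat as ℕ using (ℕ; zero; suc; _∸_; _≤ᵇ_)
open import Data.Nat.Primality using (Prime)
open import Data.Integer as ℤ using (ℤ; +_; -_; _+_; _*_; _^_)
open import Data.Integer.Divisibility using (_∣_)
open import Data.Fin using (Fin; toℕ; punchIn) renaming (zero to fzero; suc to fsuc)
open import Data.Bool using (if_then_else_; _∧_)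
open import Data.List using (List; []; _∷_; _++_; length; map)
open import Data.Vec using (Vec; []; _∷_)
open import Data.Product using (Σ; ∃; ∃-syntax; _×_)
open import Relation.Binary.PropositionalEquality using (_≡_)
open import Relation.Nullary using (¬_)

-- Polynomials over ℤ: coefficient lists, lowest degree first.
Poly : Set
Poly = List ℤ

coeff : Poly → ℕ → ℤ
coeff []       _       = + 0
coeff (a ∷ f)  zero    = a
coeff (a ∷ f)  (suc i) = coeff f i

infixl 6 _+ₚ_
infixl 7 _*ₚ_

_+ₚ_ : Poly → Poly → Poly
[]      +ₚ g       = g
(a ∷ f) +ₚ []      = a ∷ f
(a ∷ f) +ₚ (b ∷ g) = (a + b) ∷ (f +ₚ g)

_*ₚ_ : Poly → Poly → Poly
[]      *ₚ g = []
(a ∷ f) *ₚ g = map (a *_) g +ₚ (+ 0 ∷ (f *ₚ g))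

eval : Poly → ℤ → ℤ
eval []      x = + 0
eval (a ∷ f) x = a + x * eval f x

derivFrom : ℕ → Poly → Poly
derivFrom k []      = []
derivFrom k (b ∷ f) = (+ k * b) ∷ derivFrom (suc k) f

deriv : Poly → Poly
deriv []      = []
deriv (a ∷ f) = derivFrom 1 f

-- monic: leading coefficient 1 (list ends with 1); degree = length cs
Monic : Poly → Set
Monic h = ∃[ cs ] h ≡ cs ++ (+ 1 ∷ [])

deg : Poly → ℕ
deg f = length f ∸ 1

sumFin : ∀ n → (Fin n → ℤ) → ℤ
sumFin zero    f = + 0
sumFin (suc n) f = f fzero + sumFin n (λ i → f (fsuc i))

det : ∀ n → (Fin n → Fin n → ℤ) → ℤ
det zero    M = + 1
det (suc n) M =
  sumFin (suc n) (λ i → ((- + 1) ^ toℕ i) * M i fzero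
                         * det n (λ r c → M (punchIn i r) (fsuc c)))

-- entry (i,j) of a row of the Sylvester matrix built from f of degree d,
-- shifted by i: coefficient f_{d-(j-i)} when 0 ≤ j-i ≤ d, else 0.
sylRow : Poly → ℕ → ℕ → ℕ → ℤ
sylRow f d i j = if (i ≤ᵇ j) ∧ ((j ∸ i) ≤ᵇ d) then coeff f (d ∸ (j ∸ i)) else + 0

-- Sylvester matrix of f (degree m) and g (degree n): size m+n,
-- first n rows from f, last m rows from g.
sylvester : (f g : Poly) (m n : ℕ) → Fin (m ℕ.+ n) → Fin (m ℕ.+ n) → ℤ
sylvester f g m n r c =
  if suc (toℕ r) ≤ᵇ n then sylRow f m (toℕ r) (toℕ c)
  else sylRow g n (toℕ r ∸ n) (toℕ c)

resultant : (f g : Poly) (m n : ℕ) → ℤ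
resultant f g m n = det (m ℕ.+ n) (sylvester f g m n)

-- discriminant of a monic polynomial h of degree n:
-- disc h = (-1)^{n(n-1)/2} Res(h, h')   (leading coefficient 1)
disc : Poly → ℤ
disc h = ((- + 1) ^ ((n ℕ.* (n ∸ 1)) ℕ./ 2)) * resultant h (deriv h) n (n ∸ 1)
  where n = deg h

_≡ₚ_[mod_] : Poly → Poly → ℕ → Set
f ≡ₚ g [mod p ] = ∀ i → (+ p) ∣ (coeff f i ℤ.- coeff g i)

linProd : ∀ {n} → Vec ℤ n → Poly
linProd []       = + 1 ∷ []
linProd (r ∷ rs) = (- r ∷ + 1 ∷ []) *ₚ linProd rs

SplitsMod : Poly → ℕ → Set
SplitsMod h p = ∃[ rs ] h ≡ₚ linProd {deg h} rs [mod p ]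

_∣ₚ_ : Poly → Poly → Set
h ∣ₚ g = ∃[ q ] (∀ i → coeff g i ≡ coeff (h *ₚ q) i)

-- Divide g by the monic h: g = h q + R with deg R < deg h.  Let p > ∣disc h∣ be one of the primes of
-- the hypothesis, so h ≡ ∏ (x - rᵢ) (mod p).  A common root of h and h′ modulo p would make p divide
-- the resultant of h and h′, hence disc h; so the rᵢ are pairwise distinct modulo p.  Every rᵢ is a
-- root of g, hence of R, modulo p; as deg R < deg h, all coefficients of R are divisible by p (over
-- 𝔽ₚ a polynomial with more distinct roots than its degree is zero).  Since p may be taken larger
-- than any given coefficient of R, R = 0.

module Submission where

open import Defs
open import Data.Nat using (ℕ; _>_)
open import Data.Nat.Primality using (Prime)
open import Data.Integer using (ℤ; +_)
open import Data.Integer.Divisibility using (_∣_)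
open import Data.Product using (∃-syntax; _×_)
open import Relation.Binary.PropositionalEquality using (_≢_)

open import Data.Nat as ℕ using (zero; suc; _∸_; z≤n; s≤s; _≤ᵇ_; _⊔_)
  renaming (_<_ to _<ℕ_; _≤_ to _≤ℕ_)
import Data.Nat.Properties as ℕP
import Data.Nat.Divisibility as ℕD
open import Data.Nat.Primality using (euclidsLemma; ¬prime[1])
open import Data.Bool using (true; false; if_then_else_; _∧_)
open import Data.Integer using (-_; _+_; _*_; _-_; _^_; 0ℤ; 1ℤ; -1ℤ; ∣_∣)
import Data.Integer.Properties as ℤP
import Data.Integer.Divisibility.Signed as S
open import Data.Integer.Tactic.RingSolver using (solve-∀)
open import Data.List using ([]; _∷_; _++_; map; length)
open import Data.List.Properties using (length-++)
open import Data.Vec using (Vec; []; _∷_; lookup)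
open import Data.Fin using (Fin; toℕ; punchIn) renaming (zero to fzero; suc to fsuc)
open import Data.Product using (_,_; proj₁; proj₂)
open import Data.Sum using (_⊎_; inj₁; inj₂)
open import Data.Empty using (⊥; ⊥-elim)
open import Data.Unit using (⊤; tt)
open import Function using (_∘_)
open import Relation.Nullary using (¬_; yes; no)
open import Relation.Binary.PropositionalEquality

-- Finite sums over ℕ-indexed families

∑ : ℕ → (ℕ → ℤ) → ℤ
∑ zero    f = 0ℤ
∑ (suc n) f = f 0 + ∑ n (f ∘ suc)

∑-cong : ∀ n {f g : ℕ → ℤ} → (∀ i → i <ℕ n → f i ≡ g i) → ∑ n f ≡ ∑ n g
∑-cong zero    f≡g = refl
∑-cong (suc n) f≡g = cong₂ _+_ (f≡g 0 (s≤s z≤n)) (∑-cong n (λ i i<n → f≡g (suc i) (s≤s i<n)))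

∑-cong′ : ∀ n {f g : ℕ → ℤ} → (∀ i → f i ≡ g i) → ∑ n f ≡ ∑ n g
∑-cong′ n f≡g = ∑-cong n (λ i _ → f≡g i)

∑-zero : ∀ n (f : ℕ → ℤ) → (∀ i → i <ℕ n → f i ≡ 0ℤ) → ∑ n f ≡ 0ℤ
∑-zero zero    f f≡0 = refl
∑-zero (suc n) f f≡0 = cong₂ _+_ (f≡0 0 (s≤s z≤n)) (∑-zero n _ (λ i i<n → f≡0 (suc i) (s≤s i<n)))

∑-distrib-+ : ∀ n (f g : ℕ → ℤ) → ∑ n (λ i → f i + g i) ≡ ∑ n f + ∑ n g
∑-distrib-+ zero    f g = refl
∑-distrib-+ (suc n) f g = trans (cong (_+_ (f 0 + g 0)) (∑-distrib-+ n _ _)) (shuffle (f 0) (g 0) _ _)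
  where shuffle : ∀ a b c d → a + b + (c + d) ≡ a + c + (b + d)
        shuffle = solve-∀

∑-distrib-- : ∀ n (f g : ℕ → ℤ) → ∑ n (λ i → f i - g i) ≡ ∑ n f - ∑ n g
∑-distrib-- zero    f g = refl
∑-distrib-- (suc n) f g = trans (cong (_+_ (f 0 - g 0)) (∑-distrib-- n _ _)) (shuffle (f 0) (g 0) _ _)
  where shuffle : ∀ a b c d → a - b + (c - d) ≡ a + c - (b + d)
        shuffle = solve-∀

*-distribˡ-∑ : ∀ n c (f : ℕ → ℤ) → ∑ n (λ i → c * f i) ≡ c * ∑ n f
*-distribˡ-∑ zero    c f = sym (ℤP.*-zeroʳ c)
*-distribˡ-∑ (suc n) c f = trans (cong (_+_ (c * f 0)) (*-distribˡ-∑ n c _)) (sym (ℤP.*-distribˡ-+ c (f 0) _))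

*-distribʳ-∑ : ∀ n c (f : ℕ → ℤ) → ∑ n (λ i → f i * c) ≡ ∑ n f * c
*-distribʳ-∑ zero    c f = refl
*-distribʳ-∑ (suc n) c f = trans (cong (_+_ (f 0 * c)) (*-distribʳ-∑ n c _)) (sym (ℤP.*-distribʳ-+ c (f 0) _))

neg-distrib-∑ : ∀ n (f : ℕ → ℤ) → ∑ n (λ i → - f i) ≡ - ∑ n f
neg-distrib-∑ n f = begin
  ∑ n (λ i → - f i)     ≡⟨ ∑-cong′ n (λ i → sym (ℤP.-1*i≡-i (f i))) ⟩
  ∑ n (λ i → -1ℤ * f i) ≡⟨ *-distribˡ-∑ n -1ℤ f ⟩
  -1ℤ * ∑ n f           ≡⟨ ℤP.-1*i≡-i (∑ n f) ⟩
  - ∑ n f               ∎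
  where open ≡-Reasoning

∑-split : ∀ m n (f : ℕ → ℤ) → ∑ (m ℕ.+ n) f ≡ ∑ m f + ∑ n (λ j → f (m ℕ.+ j))
∑-split zero    n f = sym (ℤP.+-identityˡ _)
∑-split (suc m) n f = trans (cong (_+_ (f 0)) (∑-split m n _)) (sym (ℤP.+-assoc (f 0) _ _))

∑-last : ∀ n (f : ℕ → ℤ) → ∑ (suc n) f ≡ ∑ n f + f n
∑-last zero    f = trans (ℤP.+-identityʳ (f 0)) (sym (ℤP.+-identityˡ (f 0)))
∑-last (suc n) f = trans (cong (_+_ (f 0)) (∑-last n (f ∘ suc))) (sym (ℤP.+-assoc (f 0) _ _))

∑-reverse : ∀ n (f : ℕ → ℤ) → ∑ (suc n) (λ t → f (n ∸ t)) ≡ ∑ (suc n) f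
∑-reverse zero    f = refl
∑-reverse (suc n) f = begin
  f (suc n) + ∑ (suc n) (λ t → f (n ∸ t)) ≡⟨ cong (_+_ (f (suc n))) (∑-reverse n f) ⟩
  f (suc n) + ∑ (suc n) f                 ≡⟨ ℤP.+-comm (f (suc n)) _ ⟩
  ∑ (suc n) f + f (suc n)                 ≡⟨ ∑-last (suc n) f ⟨
  ∑ (suc (suc n)) f                       ∎
  where open ≡-Reasoning

∑-comm : ∀ m n (f : ℕ → ℕ → ℤ) → ∑ m (λ i → ∑ n (f i)) ≡ ∑ n (λ j → ∑ m (λ i → f i j))
∑-comm zero    n f = sym (∑-zero n _ (λ _ _ → refl))
∑-comm (suc m) n f = trans (cong (_+_ (∑ n (f 0))) (∑-comm m n (f ∘ suc))) (sym (∑-distrib-+ n _ _))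

∑-triangle : ∀ n (F : ℕ → ℕ → ℤ) →
  ∑ n (λ b → ∑ b (λ a → F a b)) ≡ ∑ n (λ a → ∑ (n ∸ suc a) (λ j → F a (suc (a ℕ.+ j))))
∑-triangle zero    F = refl
∑-triangle (suc n) F = begin
  0ℤ + ∑ n (λ b → F 0 (suc b) + ∑ b (λ a → F (suc a) (suc b)))
    ≡⟨ ℤP.+-identityˡ _ ⟩
  ∑ n (λ b → F 0 (suc b) + ∑ b (λ a → F (suc a) (suc b)))
    ≡⟨ ∑-distrib-+ n _ _ ⟩
  ∑ n (λ b → F 0 (suc b)) + ∑ n (λ b → ∑ b (λ a → F (suc a) (suc b)))
    ≡⟨ cong (_+_ (∑ n (λ b → F 0 (suc b)))) (∑-triangle n (λ a b → F (suc a) (suc b))) ⟩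
  ∑ n (λ b → F 0 (suc b)) + ∑ n (λ a → ∑ (n ∸ suc a) (λ j → F (suc a) (suc (suc (a ℕ.+ j)))))
    ∎
  where open ≡-Reasoning

∣-∑ : ∀ n {p} (f : ℕ → ℤ) → (∀ i → i <ℕ n → p S.∣ f i) → p S.∣ ∑ n f
∣-∑ zero    f p∣f = S.divides 0ℤ refl
∣-∑ (suc n) f p∣f = S.∣m∣n⇒∣m+n (p∣f 0 (s≤s z≤n)) (∣-∑ n (f ∘ suc) (λ i i<n → p∣f (suc i) (s≤s i<n)))

-- Determinants of ℕ-indexed matrices

-- ℕ-indexed matrices spare us Fin arithmetic; det≡detℕ transfers the results to Defs.det.
Matrix : Set
Matrix = ℕ → ℕ → ℤ

punchInℕ : ℕ → ℕ → ℕ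
punchInℕ zero    r       = suc r
punchInℕ (suc i) zero    = zero
punchInℕ (suc i) (suc r) = suc (punchInℕ i r)

punchInℕ-< : ∀ i r → r <ℕ i → punchInℕ i r ≡ r
punchInℕ-< (suc i) zero    _         = refl
punchInℕ-< (suc i) (suc r) (s≤s r<i) = cong suc (punchInℕ-< i r r<i)

punchInℕ-+ : ∀ i j → punchInℕ i (i ℕ.+ j) ≡ suc (i ℕ.+ j)
punchInℕ-+ zero    j = refl
punchInℕ-+ (suc i) j = cong suc (punchInℕ-+ i j)

punchInℕ-comm : ∀ i k r → i ≤ℕ k → punchInℕ i (punchInℕ k r) ≡ punchInℕ (suc k) (punchInℕ i r)
punchInℕ-comm zero    k       r       _         = refl
punchInℕ-comm (suc i) (suc k) zero    _         = refl
punchInℕ-comm (suc i) (suc k) (suc r) (s≤s i≤k) = cong suc (punchInℕ-comm i k r i≤k)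

punchInℕ-<-suc : ∀ n i r → i ≤ℕ n → r <ℕ n → punchInℕ i r <ℕ suc n
punchInℕ-<-suc n       zero    r       _         r<n       = s≤s r<n
punchInℕ-<-suc n       (suc i) zero    _         _         = s≤s z≤n
punchInℕ-<-suc (suc n) (suc i) (suc r) (s≤s i≤n) (s≤s r<n) = s≤s (punchInℕ-<-suc n i r i≤n r<n)

toℕ-punchIn : ∀ {n} (i : Fin (suc n)) (r : Fin n) → toℕ (punchIn i r) ≡ punchInℕ (toℕ i) (toℕ r)
toℕ-punchIn fzero    r        = refl
toℕ-punchIn (fsuc i) fzero    = refl
toℕ-punchIn (fsuc i) (fsuc r) = cong suc (toℕ-punchIn i r)

sgn : ℕ → ℤ
sgn i = -1ℤ ^ i

minor : ℕ → Matrix → Matrix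
minor i A r c = A (punchInℕ i r) (suc c)

detℕ : ℕ → Matrix → ℤ
detℕ zero    A = 1ℤ
detℕ (suc n) A = ∑ (suc n) (λ i → sgn i * A i 0 * detℕ n (minor i A))

detℕ-cong : ∀ n {A B : Matrix} → (∀ r c → A r c ≡ B r c) → detℕ n A ≡ detℕ n B
detℕ-cong zero    A≡B = refl
detℕ-cong (suc n) A≡B = ∑-cong′ (suc n) λ i →
  cong₂ _*_ (cong (_*_ (sgn i)) (A≡B i 0)) (detℕ-cong n (λ r c → A≡B (punchInℕ i r) (suc c)))

∑Fin≡∑ : ∀ n (f : Fin n → ℤ) (F : ℕ → ℤ) → (∀ i → f i ≡ F (toℕ i)) → sumFin n f ≡ ∑ n F
∑Fin≡∑ zero    f F f≡F = refl
∑Fin≡∑ (suc n) f F f≡F = cong₂ _+_ (f≡F fzero) (∑Fin≡∑ n (f ∘ fsuc) (F ∘ suc) (f≡F ∘ fsuc))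

det≡detℕ : ∀ n (M : Fin n → Fin n → ℤ) (A : Matrix) → (∀ r c → M r c ≡ A (toℕ r) (toℕ c)) →
           det n M ≡ detℕ n A
det≡detℕ zero    M A M≡A = refl
det≡detℕ (suc n) M A M≡A = ∑Fin≡∑ (suc n) _ (λ i → sgn i * A i 0 * detℕ n (minor i A)) λ i →
  cong₂ _*_ (cong (_*_ (sgn (toℕ i))) (M≡A i fzero))
            (det≡detℕ n _ (minor (toℕ i) A) λ r c →
               trans (M≡A (punchIn i r) (fsuc c)) (cong (λ k → A k (suc (toℕ c))) (toℕ-punchIn i r)))

cofactor₂ : ℕ → Matrix → ℕ → ℕ → ℤ
cofactor₂ n A a b = sgn a * sgn b * detℕ n (minor a (minor b A))

∑-pairs : ℕ → Matrix → (ℕ → ℕ → ℤ) → ℤ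
∑-pairs n A U = ∑ (suc (suc n)) (λ b → ∑ b (λ a → U b a * cofactor₂ n A a b))

∑-pairs-cong : ∀ n A {U V : ℕ → ℕ → ℤ} → (∀ b a → U b a ≡ V b a) → ∑-pairs n A U ≡ ∑-pairs n A V
∑-pairs-cong n A U≡V = ∑-cong′ (suc (suc n)) λ b → ∑-cong′ b λ a → cong (_* cofactor₂ n A a b) (U≡V b a)

-- The i-th term of the first-column expansion, with its minor expanded in turn,
-- split according to whether the second row used lies above or below row i.
laplace-term : ∀ n A i → i ≤ℕ suc n →
  sgn i * A i 0 * detℕ (suc n) (minor i A)
  ≡ ∑ i (λ a → A i 0 * A a 1 * cofactor₂ n A a i)
    - ∑ (suc n ∸ i) (λ j → A i 0 * A (suc (i ℕ.+ j)) 1 * cofactor₂ n A i (suc (i ℕ.+ j)))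
laplace-term n A i i≤1+n = begin
  sgn i * A i 0 * ∑ (suc n) term
    ≡⟨ *-distribˡ-∑ (suc n) (sgn i * A i 0) term ⟨
  ∑ (suc n) (λ k → sgn i * A i 0 * term k)
    ≡⟨ cong (λ m → ∑ m (λ k → sgn i * A i 0 * term k)) (ℕP.m+[n∸m]≡n i≤1+n) ⟨
  ∑ (i ℕ.+ (suc n ∸ i)) (λ k → sgn i * A i 0 * term k)
    ≡⟨ ∑-split i (suc n ∸ i) _ ⟩
  ∑ i (λ k → sgn i * A i 0 * term k) + ∑ (suc n ∸ i) (λ j → sgn i * A i 0 * term (i ℕ.+ j))
    ≡⟨ cong₂ _+_ (∑-cong i above) (trans (∑-cong′ (suc n ∸ i) below) (neg-distrib-∑ (suc n ∸ i) _)) ⟩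
  ∑ i (λ a → A i 0 * A a 1 * cofactor₂ n A a i)
    - ∑ (suc n ∸ i) (λ j → A i 0 * A (suc (i ℕ.+ j)) 1 * cofactor₂ n A i (suc (i ℕ.+ j)))
    ∎
  where
  open ≡-Reasoning
  term : ℕ → ℤ
  term k = sgn k * minor i A k 0 * detℕ n (minor k (minor i A))
  reorder : ∀ s a b w t → s * a * (t * b * w) ≡ a * b * (t * s * w)
  reorder = solve-∀
  reorder⁻ : ∀ s a b w t → s * a * (t * b * w) ≡ - (a * b * (s * (-1ℤ * t) * w))
  reorder⁻ = solve-∀
  above : ∀ k → k <ℕ i → sgn i * A i 0 * term k ≡ A i 0 * A k 1 * cofactor₂ n A k i
  above k k<i rewrite punchInℕ-< i k k<i = reorder (sgn i) (A i 0) (A k 1) _ (sgn k)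
  below : ∀ j → sgn i * A i 0 * term (i ℕ.+ j)
              ≡ - (A i 0 * A (suc (i ℕ.+ j)) 1 * cofactor₂ n A i (suc (i ℕ.+ j)))
  below j rewrite punchInℕ-+ i j =
    trans (cong (λ w → sgn i * A i 0 * (sgn (i ℕ.+ j) * A (suc (i ℕ.+ j)) 1 * w))
                (detℕ-cong n λ r c →
                   cong (λ k → A k (suc (suc c))) (punchInℕ-comm i (i ℕ.+ j) r (ℕP.m≤m+n i j))))
          (reorder⁻ (sgn i) (A i 0) (A (suc (i ℕ.+ j)) 1) _ (sgn (i ℕ.+ j)))

-- Laplace expansion along the first two columns: a 2×2 minor on rows a < b
-- times its complementary cofactor.
detℕ-laplace₂ : ∀ n A →
  detℕ (suc (suc n)) A ≡ ∑-pairs n A (λ b a → A b 0 * A a 1) - ∑-pairs n A (λ b a → A a 0 * A b 1)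
detℕ-laplace₂ n A = begin
  detℕ (suc (suc n)) A
    ≡⟨ ∑-cong (suc (suc n)) (λ { i (s≤s i≤1+n) → laplace-term n A i i≤1+n }) ⟩
  ∑ (suc (suc n)) (λ i → P i - Q i)
    ≡⟨ ∑-distrib-- (suc (suc n)) P Q ⟩
  ∑ (suc (suc n)) P - ∑ (suc (suc n)) Q
    ≡⟨ cong (_-_ (∑ (suc (suc n)) P))
            (∑-triangle (suc (suc n)) (λ a b → A a 0 * A b 1 * cofactor₂ n A a b)) ⟨
  ∑-pairs n A (λ b a → A b 0 * A a 1) - ∑-pairs n A (λ b a → A a 0 * A b 1)
    ∎
  where
  open ≡-Reasoning
  P Q : ℕ → ℤ
  P i = ∑ i (λ a → A i 0 * A a 1 * cofactor₂ n A a i)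
  Q i = ∑ (suc n ∸ i) (λ j → A i 0 * A (suc (i ℕ.+ j)) 1 * cofactor₂ n A i (suc (i ℕ.+ j)))

swap₀₁ : Matrix → Matrix
swap₀₁ A r zero          = A r 1
swap₀₁ A r (suc zero)    = A r 0
swap₀₁ A r (suc (suc c)) = A r (suc (suc c))

detℕ-swap₀₁ : ∀ n A → detℕ (suc (suc n)) (swap₀₁ A) ≡ - detℕ (suc (suc n)) A
detℕ-swap₀₁ n A = begin
  detℕ (suc (suc n)) (swap₀₁ A)
    ≡⟨ detℕ-laplace₂ n (swap₀₁ A) ⟩
  ∑-pairs n A (λ b a → A b 1 * A a 0) - ∑-pairs n A (λ b a → A a 1 * A b 0)
    ≡⟨ cong₂ _-_ (∑-pairs-cong n A λ b a → ℤP.*-comm (A b 1) (A a 0))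
                 (∑-pairs-cong n A λ b a → ℤP.*-comm (A a 1) (A b 0)) ⟩
  ∑-pairs n A (λ b a → A a 0 * A b 1) - ∑-pairs n A (λ b a → A b 0 * A a 1)
    ≡⟨ antisym (∑-pairs n A (λ b a → A a 0 * A b 1)) (∑-pairs n A (λ b a → A b 0 * A a 1)) ⟩
  - (∑-pairs n A (λ b a → A b 0 * A a 1) - ∑-pairs n A (λ b a → A a 0 * A b 1))
    ≡⟨ cong -_ (detℕ-laplace₂ n A) ⟨
  - detℕ (suc (suc n)) A
    ∎
  where
  open ≡-Reasoning
  antisym : ∀ x y → x - y ≡ - (y - x)
  antisym = solve-∀

i≡-i⇒i≡0 : ∀ i → i ≡ - i → i ≡ 0ℤ
i≡-i⇒i≡0 i i≡-i =
  ℤP.*-cancelˡ-≡ (+ 2) i 0ℤ (trans (double i) (trans (cong (_+_ i) i≡-i) (ℤP.+-inverseʳ i)))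
  where double : ∀ i → + 2 * i ≡ i + i
        double = solve-∀

-- Swapping the first two columns negates the determinant; for j = 0 this leaves A unchanged,
-- otherwise it moves the repeated column into every minor of the expansion along column 0.
detℕ-equal-columns : ∀ n A j → suc j <ℕ n → (∀ r → A r 0 ≡ A r (suc j)) → detℕ n A ≡ 0ℤ
detℕ-equal-columns (suc zero) A j (s≤s ()) _
detℕ-equal-columns (suc (suc n)) A zero _ col₀≡col₁ =
  i≡-i⇒i≡0 _ (trans (sym (detℕ-cong (suc (suc n)) swap₀₁A≡A)) (detℕ-swap₀₁ n A))
  where
  swap₀₁A≡A : ∀ r c → swap₀₁ A r c ≡ A r c
  swap₀₁A≡A r zero          = sym (col₀≡col₁ r)
  swap₀₁A≡A r (suc zero)    = col₀≡col₁ r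
  swap₀₁A≡A r (suc (suc c)) = refl
detℕ-equal-columns (suc (suc n)) A (suc j) (s≤s (s≤s j<n)) col₀≡col₂₊ⱼ =
  trans (sym (ℤP.neg-involutive _)) (trans (cong -_ (sym (detℕ-swap₀₁ n A))) (cong -_ swapped≡0))
  where
  swapped≡0 : detℕ (suc (suc n)) (swap₀₁ A) ≡ 0ℤ
  swapped≡0 = ∑-zero (suc (suc n)) _ λ i _ →
    trans (cong (_*_ (sgn i * swap₀₁ A i 0))
                (detℕ-equal-columns (suc n) (minor i (swap₀₁ A)) j (s≤s j<n) (col₀≡col₂₊ⱼ ∘ punchInℕ i)))
          (ℤP.*-zeroʳ (sgn i * swap₀₁ A i 0))

∣column⇒∣detℕ : ∀ n A j {p} → j <ℕ n → (∀ r → r <ℕ n → p S.∣ A r j) → p S.∣ detℕ n A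
∣column⇒∣detℕ (suc n) A zero _ p∣col = ∣-∑ (suc n) _ λ i i<1+n →
  S.∣m⇒∣m*n (detℕ n (minor i A)) (S.∣n⇒∣m*n (sgn i) (p∣col i i<1+n))
∣column⇒∣detℕ (suc n) A (suc j) (s≤s j<n) p∣col = ∣-∑ (suc n) _ λ { i (s≤s i≤n) →
  S.∣n⇒∣m*n (sgn i * A i 0)
    (∣column⇒∣detℕ n (minor i A) j j<n λ r r<n → p∣col (punchInℕ i r) (punchInℕ-<-suc n i r i≤n r<n)) }

withColumn₀ : Matrix → ℕ → Matrix
withColumn₀ A c r zero    = A r c
withColumn₀ A c r (suc d) = A r (suc d)

-- Replacing column 0 by the combination ∑ v c · (column c) scales the determinant by v 0:
-- the expansion is linear in column 0 and the other columns give repeated columns.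
detℕ-combine-column₀ : ∀ n A (v : ℕ → ℤ) →
  ∑ (suc n) (λ i → sgn i * ∑ (suc n) (λ c → v c * A i c) * detℕ n (minor i A)) ≡ v 0 * detℕ (suc n) A
detℕ-combine-column₀ n A v = begin
  ∑ (suc n) (λ i → sgn i * ∑ (suc n) (λ c → v c * A i c) * M i)
    ≡⟨ ∑-cong′ (suc n) (λ i → trans (cong (_* M i) (sym (*-distribˡ-∑ (suc n) (sgn i) (λ c → v c * A i c))))
                                    (sym (*-distribʳ-∑ (suc n) (M i) (λ c → sgn i * (v c * A i c))))) ⟩
  ∑ (suc n) (λ i → ∑ (suc n) (λ c → sgn i * (v c * A i c) * M i))
    ≡⟨ ∑-comm (suc n) (suc n) (λ i c → sgn i * (v c * A i c) * M i) ⟩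
  ∑ (suc n) (λ c → ∑ (suc n) (λ i → sgn i * (v c * A i c) * M i))
    ≡⟨ ∑-cong′ (suc n) (λ c → trans (∑-cong′ (suc n) (λ i → reorder (sgn i) (v c) (A i c) (M i)))
                                     (*-distribˡ-∑ (suc n) (v c) (λ i → sgn i * A i c * M i))) ⟩
  v 0 * expansion 0 + ∑ n (λ c → v (suc c) * expansion (suc c))
    ≡⟨ cong (_+_ (v 0 * expansion 0)) (∑-zero n (λ c → v (suc c) * expansion (suc c)) λ c c<n →
         trans (cong (_*_ (v (suc c)))
                     (detℕ-equal-columns (suc n) (withColumn₀ A (suc c)) c (s≤s c<n) λ _ → refl))
               (ℤP.*-zeroʳ (v (suc c)))) ⟩
  v 0 * detℕ (suc n) A + 0ℤ
    ≡⟨ ℤP.+-identityʳ _ ⟩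
  v 0 * detℕ (suc n) A
    ∎
  where
  open ≡-Reasoning
  M : ℕ → ℤ
  M i = detℕ n (minor i A)
  expansion : ℕ → ℤ
  expansion c = ∑ (suc n) (λ i → sgn i * A i c * M i)
  reorder : ∀ s x y m → s * (x * y) * m ≡ x * (s * y * m)
  reorder = solve-∀

∣rows⇒∣*detℕ : ∀ n A (v : ℕ → ℤ) {p} → (∀ r → r <ℕ suc n → p S.∣ ∑ (suc n) (λ c → v c * A r c)) →
               p S.∣ v 0 * detℕ (suc n) A
∣rows⇒∣*detℕ n A v p∣rows = subst (_ S.∣_) (detℕ-combine-column₀ n A v) (∣-∑ (suc n) _ λ i i<1+n →
  S.∣m⇒∣m*n (detℕ n (minor i A)) (S.∣n⇒∣m*n (sgn i) (p∣rows i i<1+n)))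

-- Polynomials: evaluation, derivative and division

coeff-+ₚ : ∀ f g i → coeff (f +ₚ g) i ≡ coeff f i + coeff g i
coeff-+ₚ []      g       i       = sym (ℤP.+-identityˡ _)
coeff-+ₚ (a ∷ f) []      i       = sym (ℤP.+-identityʳ _)
coeff-+ₚ (a ∷ f) (b ∷ g) zero    = refl
coeff-+ₚ (a ∷ f) (b ∷ g) (suc i) = coeff-+ₚ f g i

coeff-scale : ∀ c f i → coeff (map (c *_) f) i ≡ c * coeff f i
coeff-scale c []      i       = sym (ℤP.*-zeroʳ c)
coeff-scale c (a ∷ f) zero    = refl
coeff-scale c (a ∷ f) (suc i) = coeff-scale c f i

coeff-beyond : ∀ f i → length f ≤ℕ i → coeff f i ≡ 0ℤ
coeff-beyond []      i       _         = refl
coeff-beyond (a ∷ f) (suc i) (s≤s f≤i) = coeff-beyond f i f≤i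

coeff-*ₚ-[] : ∀ f i → coeff (f *ₚ []) i ≡ 0ℤ
coeff-*ₚ-[] []      i       = refl
coeff-*ₚ-[] (a ∷ f) zero    = refl
coeff-*ₚ-[] (a ∷ f) (suc i) = coeff-*ₚ-[] f i

coeff-*ₚ-∷ : ∀ f c q i → coeff (f *ₚ (c ∷ q)) i ≡ c * coeff f i + coeff (+ 0 ∷ (f *ₚ q)) i
coeff-*ₚ-∷ []      c q zero    = sym (trans (ℤP.+-identityʳ (c * 0ℤ)) (ℤP.*-zeroʳ c))
coeff-*ₚ-∷ []      c q (suc i) = sym (trans (ℤP.+-identityʳ (c * 0ℤ)) (ℤP.*-zeroʳ c))
coeff-*ₚ-∷ (a ∷ f) c q zero    = cong (_+ 0ℤ) (ℤP.*-comm a c)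
coeff-*ₚ-∷ (a ∷ f) c q (suc i) = begin
  coeff (map (a *_) q +ₚ (f *ₚ (c ∷ q))) i
    ≡⟨ coeff-+ₚ (map (a *_) q) (f *ₚ (c ∷ q)) i ⟩
  coeff (map (a *_) q) i + coeff (f *ₚ (c ∷ q)) i
    ≡⟨ cong₂ _+_ (coeff-scale a q i) (coeff-*ₚ-∷ f c q i) ⟩
  a * coeff q i + (c * coeff f i + coeff (+ 0 ∷ (f *ₚ q)) i)
    ≡⟨ swap (a * coeff q i) (c * coeff f i) _ ⟩
  c * coeff f i + (a * coeff q i + coeff (+ 0 ∷ (f *ₚ q)) i)
    ≡⟨ cong (_+_ (c * coeff f i)) (cong (_+ coeff (+ 0 ∷ (f *ₚ q)) i) (coeff-scale a q i)) ⟨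
  c * coeff f i + (coeff (map (a *_) q) i + coeff (+ 0 ∷ (f *ₚ q)) i)
    ≡⟨ cong (_+_ (c * coeff f i)) (coeff-+ₚ (map (a *_) q) (+ 0 ∷ (f *ₚ q)) i) ⟨
  c * coeff f i + coeff ((a ∷ f) *ₚ q) i
    ∎
  where
  open ≡-Reasoning
  swap : ∀ x y w → x + (y + w) ≡ y + (x + w)
  swap = solve-∀

eval-+ₚ : ∀ f g x → eval (f +ₚ g) x ≡ eval f x + eval g x
eval-+ₚ []      g       x = sym (ℤP.+-identityˡ _)
eval-+ₚ (a ∷ f) []      x = sym (ℤP.+-identityʳ _)
eval-+ₚ (a ∷ f) (b ∷ g) x =
  trans (cong (λ e → a + b + x * e) (eval-+ₚ f g x)) (horner a b x (eval f x) (eval g x))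
  where horner : ∀ a b x e₁ e₂ → a + b + x * (e₁ + e₂) ≡ a + x * e₁ + (b + x * e₂)
        horner = solve-∀

eval-scale : ∀ c f x → eval (map (c *_) f) x ≡ c * eval f x
eval-scale c []      x = sym (ℤP.*-zeroʳ c)
eval-scale c (a ∷ f) x = trans (cong (λ e → c * a + x * e) (eval-scale c f x)) (horner c a x (eval f x))
  where horner : ∀ c a x e → c * a + x * (c * e) ≡ c * (a + x * e)
        horner = solve-∀

eval-*ₚ : ∀ f g x → eval (f *ₚ g) x ≡ eval f x * eval g x
eval-*ₚ []      g x = refl
eval-*ₚ (a ∷ f) g x = begin
  eval (map (a *_) g +ₚ (+ 0 ∷ (f *ₚ g))) x
    ≡⟨ eval-+ₚ (map (a *_) g) (+ 0 ∷ (f *ₚ g)) x ⟩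
  eval (map (a *_) g) x + (+ 0 + x * eval (f *ₚ g) x)
    ≡⟨ cong₂ (λ u e → u + (+ 0 + x * e)) (eval-scale a g x) (eval-*ₚ f g x) ⟩
  a * eval g x + (+ 0 + x * (eval f x * eval g x))
    ≡⟨ horner a x (eval f x) (eval g x) ⟩
  (a + x * eval f x) * eval g x
    ∎
  where
  open ≡-Reasoning
  horner : ∀ a x e₁ e₂ → a * e₂ + (+ 0 + x * (e₁ * e₂)) ≡ (a + x * e₁) * e₂
  horner = solve-∀

eval-cong : ∀ f g x → (∀ i → coeff f i ≡ coeff g i) → eval f x ≡ eval g x
eval-cong []      []      x f≡g = refl
eval-cong []      (b ∷ g) x f≡g =
  trans (sym (trans (ℤP.+-identityˡ _) (ℤP.*-zeroʳ x)))
        (cong₂ (λ u e → u + x * e) (f≡g 0) (eval-cong [] g x (f≡g ∘ suc)))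
eval-cong (a ∷ f) []      x f≡g =
  trans (cong₂ (λ u e → u + x * e) (f≡g 0) (eval-cong f [] x (f≡g ∘ suc)))
        (trans (ℤP.+-identityˡ _) (ℤP.*-zeroʳ x))
eval-cong (a ∷ f) (b ∷ g) x f≡g = cong₂ (λ u e → u + x * e) (f≡g 0) (eval-cong f g x (f≡g ∘ suc))

eval-as-∑ : ∀ f a → eval f a ≡ ∑ (length f) (λ t → coeff f t * a ^ t)
eval-as-∑ []      a = refl
eval-as-∑ (b ∷ f) a = begin
  b + a * eval f a
    ≡⟨ cong (λ e → b + a * e) (eval-as-∑ f a) ⟩
  b + a * ∑ (length f) (λ t → coeff f t * a ^ t)
    ≡⟨ cong (_+_ b) (*-distribˡ-∑ (length f) a (λ t → coeff f t * a ^ t)) ⟨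
  b + ∑ (length f) (λ t → a * (coeff f t * a ^ t))
    ≡⟨ cong₂ _+_ (sym (ℤP.*-identityʳ b)) (∑-cong′ (length f) (λ t → shift a (coeff f t) (a ^ t))) ⟩
  b * 1ℤ + ∑ (length f) (λ t → coeff f t * (a * a ^ t))
    ∎
  where
  open ≡-Reasoning
  shift : ∀ a c e → a * (c * e) ≡ c * (a * e)
  shift = solve-∀

evalDeriv : Poly → ℤ → ℤ
evalDeriv f x = eval (deriv f) x

eval-derivFrom-suc : ∀ k f x → eval (derivFrom (suc k) f) x ≡ eval (derivFrom k f) x + eval f x
eval-derivFrom-suc k []      x = refl
eval-derivFrom-suc k (b ∷ f) x =
  trans (cong (λ e → + suc k * b + x * e) (eval-derivFrom-suc (suc k) f x)) (horner (+ k) b x _ _)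
  where horner : ∀ k b x E e → (+ 1 + k) * b + x * (E + e) ≡ (k * b + x * E) + (b + x * e)
        horner = solve-∀

eval-derivFrom-zero : ∀ f x → eval (derivFrom 0 f) x ≡ x * evalDeriv f x
eval-derivFrom-zero []      x = sym (ℤP.*-zeroʳ x)
eval-derivFrom-zero (b ∷ f) x =
  trans (cong (_+ x * eval (derivFrom 1 f) x) (ℤP.*-zeroˡ b)) (ℤP.+-identityˡ _)

evalDeriv-∷ : ∀ a f x → evalDeriv (a ∷ f) x ≡ eval f x + x * evalDeriv f x
evalDeriv-∷ a f x = begin
  eval (derivFrom 1 f) x                ≡⟨ eval-derivFrom-suc 0 f x ⟩
  eval (derivFrom 0 f) x + eval f x     ≡⟨ cong (_+ eval f x) (eval-derivFrom-zero f x) ⟩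
  x * evalDeriv f x + eval f x          ≡⟨ ℤP.+-comm (x * evalDeriv f x) (eval f x) ⟩
  eval f x + x * evalDeriv f x          ∎
  where open ≡-Reasoning

evalDeriv-+ₚ : ∀ f g x → evalDeriv (f +ₚ g) x ≡ evalDeriv f x + evalDeriv g x
evalDeriv-+ₚ []      g       x = sym (ℤP.+-identityˡ _)
evalDeriv-+ₚ (a ∷ f) []      x = sym (ℤP.+-identityʳ _)
evalDeriv-+ₚ (a ∷ f) (b ∷ g) x = begin
  evalDeriv ((a + b) ∷ (f +ₚ g)) x
    ≡⟨ evalDeriv-∷ (a + b) (f +ₚ g) x ⟩
  eval (f +ₚ g) x + x * evalDeriv (f +ₚ g) x
    ≡⟨ cong₂ (λ u d → u + x * d) (eval-+ₚ f g x) (evalDeriv-+ₚ f g x) ⟩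
  eval f x + eval g x + x * (evalDeriv f x + evalDeriv g x)
    ≡⟨ regroup x (eval f x) (eval g x) (evalDeriv f x) (evalDeriv g x) ⟩
  (eval f x + x * evalDeriv f x) + (eval g x + x * evalDeriv g x)
    ≡⟨ cong₂ _+_ (evalDeriv-∷ a f x) (evalDeriv-∷ b g x) ⟨
  evalDeriv (a ∷ f) x + evalDeriv (b ∷ g) x
    ∎
  where
  open ≡-Reasoning
  regroup : ∀ x e₁ e₂ d₁ d₂ → e₁ + e₂ + x * (d₁ + d₂) ≡ (e₁ + x * d₁) + (e₂ + x * d₂)
  regroup = solve-∀

evalDeriv-scale : ∀ c f x → evalDeriv (map (c *_) f) x ≡ c * evalDeriv f x
evalDeriv-scale c []      x = sym (ℤP.*-zeroʳ c)
evalDeriv-scale c (a ∷ f) x = begin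
  evalDeriv ((c * a) ∷ map (c *_) f) x
    ≡⟨ evalDeriv-∷ (c * a) (map (c *_) f) x ⟩
  eval (map (c *_) f) x + x * evalDeriv (map (c *_) f) x
    ≡⟨ cong₂ (λ u d → u + x * d) (eval-scale c f x) (evalDeriv-scale c f x) ⟩
  c * eval f x + x * (c * evalDeriv f x)
    ≡⟨ regroup c x (eval f x) (evalDeriv f x) ⟩
  c * (eval f x + x * evalDeriv f x)
    ≡⟨ cong (_*_ c) (evalDeriv-∷ a f x) ⟨
  c * evalDeriv (a ∷ f) x
    ∎
  where
  open ≡-Reasoning
  regroup : ∀ c x e d → c * e + x * (c * d) ≡ c * (e + x * d)
  regroup = solve-∀

evalDeriv-*ₚ : ∀ f g x → evalDeriv (f *ₚ g) x ≡ evalDeriv f x * eval g x + eval f x * evalDeriv g x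
evalDeriv-*ₚ []      g x = sym (cong₂ _+_ (ℤP.*-zeroˡ (eval g x)) (ℤP.*-zeroˡ (evalDeriv g x)))
evalDeriv-*ₚ (a ∷ f) g x = begin
  evalDeriv (map (a *_) g +ₚ (+ 0 ∷ (f *ₚ g))) x
    ≡⟨ evalDeriv-+ₚ (map (a *_) g) (+ 0 ∷ (f *ₚ g)) x ⟩
  evalDeriv (map (a *_) g) x + evalDeriv (+ 0 ∷ (f *ₚ g)) x
    ≡⟨ cong₂ _+_ (evalDeriv-scale a g x) (evalDeriv-∷ (+ 0) (f *ₚ g) x) ⟩
  a * evalDeriv g x + (eval (f *ₚ g) x + x * evalDeriv (f *ₚ g) x)
    ≡⟨ cong₂ (λ u d → a * evalDeriv g x + (u + x * d)) (eval-*ₚ f g x) (evalDeriv-*ₚ f g x) ⟩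
  a * dg + (ef * eg + x * (df * eg + ef * dg))
    ≡⟨ regroup a x ef eg df dg ⟩
  (ef + x * df) * eg + (a + x * ef) * dg
    ≡⟨ cong (λ d → d * eg + (a + x * ef) * dg) (evalDeriv-∷ a f x) ⟨
  evalDeriv (a ∷ f) x * eval g x + eval (a ∷ f) x * evalDeriv g x
    ∎
  where
  open ≡-Reasoning
  ef = eval f x
  eg = eval g x
  df = evalDeriv f x
  dg = evalDeriv g x
  regroup : ∀ a x ef eg df dg →
            a * dg + (ef * eg + x * (df * eg + ef * dg)) ≡ (ef + x * df) * eg + (a + x * ef) * dg
  regroup = solve-∀

x-_ : ℤ → Poly
x- r = - r ∷ + 1 ∷ []

eval-x- : ∀ r x → eval (x- r) x ≡ x - r
eval-x- r x = horner r x
  where horner : ∀ r x → - r + x * (+ 1 + x * 0ℤ) ≡ x - r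
        horner = solve-∀

evalDeriv-x- : ∀ r x → evalDeriv (x- r) x ≡ 1ℤ
evalDeriv-x- r x = horner x
  where horner : ∀ x → + 1 * + 1 + x * 0ℤ ≡ 1ℤ
        horner = solve-∀

eval-linProd-∷ : ∀ {k} r (rs : Vec ℤ k) x → eval (linProd (r ∷ rs)) x ≡ (x - r) * eval (linProd rs) x
eval-linProd-∷ r rs x = trans (eval-*ₚ (x- r) (linProd rs) x) (cong (_* eval (linProd rs) x) (eval-x- r x))

evalDeriv-linProd-∷ : ∀ {k} r (rs : Vec ℤ k) x →
  evalDeriv (linProd (r ∷ rs)) x ≡ eval (linProd rs) x + (x - r) * evalDeriv (linProd rs) x
evalDeriv-linProd-∷ r rs x = begin
  evalDeriv (x- r *ₚ linProd rs) x
    ≡⟨ evalDeriv-*ₚ (x- r) (linProd rs) x ⟩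
  evalDeriv (x- r) x * eval (linProd rs) x + eval (x- r) x * evalDeriv (linProd rs) x
    ≡⟨ cong₂ (λ u v → u * eval (linProd rs) x + v * evalDeriv (linProd rs) x)
             (evalDeriv-x- r x) (eval-x- r x) ⟩
  1ℤ * eval (linProd rs) x + (x - r) * evalDeriv (linProd rs) x
    ≡⟨ cong (_+ (x - r) * evalDeriv (linProd rs) x) (ℤP.*-identityˡ (eval (linProd rs) x)) ⟩
  eval (linProd rs) x + (x - r) * evalDeriv (linProd rs) x
    ∎
  where open ≡-Reasoning

eval-linProd-root : ∀ {k} (rs : Vec ℤ k) j → eval (linProd rs) (lookup rs j) ≡ 0ℤ
eval-linProd-root (r ∷ rs) fzero = trans (eval-linProd-∷ r rs r)
  (trans (cong (_* eval (linProd rs) r) (ℤP.+-inverseʳ r)) (ℤP.*-zeroˡ (eval (linProd rs) r)))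
eval-linProd-root (r ∷ rs) (fsuc j) = trans (eval-linProd-∷ r rs (lookup rs j))
  (trans (cong (_*_ (lookup rs j - r)) (eval-linProd-root rs j)) (ℤP.*-zeroʳ (lookup rs j - r)))

coeff-derivFrom : ∀ k f i → coeff (derivFrom k f) i ≡ + (k ℕ.+ i) * coeff f i
coeff-derivFrom k []      i       = sym (ℤP.*-zeroʳ (+ (k ℕ.+ i)))
coeff-derivFrom k (b ∷ f) zero    = cong (λ n → + n * b) (sym (ℕP.+-identityʳ k))
coeff-derivFrom k (b ∷ f) (suc i) =
  trans (coeff-derivFrom (suc k) f i) (cong (λ n → + n * coeff f i) (sym (ℕP.+-suc k i)))

coeff-deriv : ∀ f i → coeff (deriv f) i ≡ + suc i * coeff f (suc i)
coeff-deriv []      i = sym (ℤP.*-zeroʳ (+ suc i))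
coeff-deriv (a ∷ f) i = coeff-derivFrom 1 f i

divByLinear : ℤ → Poly → Poly
divByLinear a []      = []
divByLinear a (b ∷ f) = eval f a ∷ divByLinear a f

eval-divByLinear : ∀ a f x → eval f x ≡ (x - a) * eval (divByLinear a f) x + eval f a
eval-divByLinear a []      x = sym (trans (ℤP.+-identityʳ _) (ℤP.*-zeroʳ (x - a)))
eval-divByLinear a (b ∷ f) x =
  trans (cong (λ e → b + x * e) (eval-divByLinear a f x)) (regroup a b x (eval (divByLinear a f) x) (eval f a))
  where regroup : ∀ a b x q e → b + x * ((x - a) * q + e) ≡ (x - a) * (e + x * q) + (b + a * e)
        regroup = solve-∀

0≡0-a*0 : ∀ a → 0ℤ ≡ 0ℤ - a * 0ℤ
0≡0-a*0 = solve-∀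

coeff-divByLinear-zero : ∀ a f → coeff f 0 ≡ eval f a - a * coeff (divByLinear a f) 0
coeff-divByLinear-zero a []      = 0≡0-a*0 a
coeff-divByLinear-zero a (b ∷ f) = cancel a b (eval f a)
  where cancel : ∀ a b e → b ≡ b + a * e - a * e
        cancel = solve-∀

coeff-divByLinear-suc : ∀ a f i →
  coeff f (suc i) ≡ coeff (divByLinear a f) i - a * coeff (divByLinear a f) (suc i)
coeff-divByLinear-suc a []      i       = 0≡0-a*0 a
coeff-divByLinear-suc a (b ∷ f) zero    = coeff-divByLinear-zero a f
coeff-divByLinear-suc a (b ∷ f) (suc i) = coeff-divByLinear-suc a f i

length-derivFrom : ∀ k f → length (derivFrom k f) ≡ length f
length-derivFrom k []      = refl
length-derivFrom k (b ∷ f) = cong suc (length-derivFrom (suc k) f)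

eval-division : ∀ g h q R x → (∀ i → coeff g i ≡ coeff (h *ₚ q) i + coeff R i) →
              eval g x ≡ eval h x * eval q x + eval R x
eval-division g h q R x g≡hq+R = begin
  eval g x
    ≡⟨ eval-cong g (h *ₚ q +ₚ R) x (λ i → trans (g≡hq+R i) (sym (coeff-+ₚ (h *ₚ q) R i))) ⟩
  eval (h *ₚ q +ₚ R) x
    ≡⟨ eval-+ₚ (h *ₚ q) R x ⟩
  eval (h *ₚ q) x + eval R x
    ≡⟨ cong (_+ eval R x) (eval-*ₚ h q x) ⟩
  eval h x * eval q x + eval R x
    ∎
  where open ≡-Reasoning

-- Long division from the top: from g′ = h q′ + R′ we get b ∷ g′ = h (c ∷ q′) + ((b ∷ R′) - c h),
-- where c is the coefficient of xᵐ in b ∷ R′, so that the new remainder again has degree < m.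
divMonic : ∀ h m → coeff h m ≡ 1ℤ → length h ≡ suc m → ∀ g →
  ∃[ q ] ∃[ R ] ((∀ i → coeff g i ≡ coeff (h *ₚ q) i + coeff R i) × (∀ i → m ≤ℕ i → coeff R i ≡ 0ℤ))
divMonic h m hₘ≡1 len-h [] =
  [] , [] , (λ i → sym (trans (ℤP.+-identityʳ _) (coeff-*ₚ-[] h i))) , (λ _ _ → refl)
divMonic h m hₘ≡1 len-h (b ∷ g′) with divMonic h m hₘ≡1 len-h g′
... | q′ , R′ , g′≡hq′+R′ , deg-R′ = (c ∷ q′) , R , g≡hq+R , deg-R
  where
  c = coeff (b ∷ R′) m
  R = (b ∷ R′) +ₚ map ((- c) *_) h
  coeff-R : ∀ i → coeff R i ≡ coeff (b ∷ R′) i + (- c) * coeff h i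
  coeff-R i = trans (coeff-+ₚ (b ∷ R′) (map ((- c) *_) h) i)
                    (cong (_+_ (coeff (b ∷ R′) i)) (coeff-scale (- c) h i))
  cancel : ∀ c x A B → (c * x + A) + (B + (- c) * x) ≡ A + B
  cancel = solve-∀
  shifted : ∀ i → coeff (+ 0 ∷ (h *ₚ q′)) i + coeff (b ∷ R′) i ≡ coeff (b ∷ g′) i
  shifted zero    = ℤP.+-identityˡ b
  shifted (suc i) = sym (g′≡hq′+R′ i)
  g≡hq+R : ∀ i → coeff (b ∷ g′) i ≡ coeff (h *ₚ (c ∷ q′)) i + coeff R i
  g≡hq+R i = sym (trans (cong₂ _+_ (coeff-*ₚ-∷ h c q′ i) (coeff-R i))
                        (trans (cancel c (coeff h i) _ _) (shifted i)))
  deg-R : ∀ i → m ≤ℕ i → coeff R i ≡ 0ℤ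
  deg-R i m≤i with ℕP.m≤n⇒m<n∨m≡n m≤i
  ... | inj₂ refl = trans (coeff-R m) (trans (cong (λ w → c + (- c) * w) hₘ≡1) (top c))
    where top : ∀ c → c + (- c) * 1ℤ ≡ 0ℤ
          top = solve-∀
  deg-R (suc i) _ | inj₁ (s≤s m≤i) = trans (coeff-R (suc i))
    (trans (cong₂ (λ u w → u + (- c) * w) (deg-R′ i m≤i)
                  (coeff-beyond h (suc i) (subst (_≤ℕ suc i) (sym len-h) (s≤s m≤i))))
           (above c))
    where above : ∀ c → 0ℤ + (- c) * 0ℤ ≡ 0ℤ
          above = solve-∀

-- Sylvester matrices

≤ᵇ-true : ∀ {m n} → m ≤ℕ n → (m ≤ᵇ n) ≡ true
≤ᵇ-true {m} {n} m≤n with m ≤ᵇ n | ℕP.≤⇒≤ᵇ m≤n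
... | true | _ = refl

≤ᵇ-false : ∀ {m n} → n <ℕ m → (m ≤ᵇ n) ≡ false
≤ᵇ-false {m} {n} n<m with m ≤ᵇ n | ℕP.≤ᵇ⇒≤ m n
... | false | _   = refl
... | true  | m≤n = ⊥-elim (ℕP.<⇒≱ n<m (m≤n tt))

sylRow-< : ∀ f d i c → c <ℕ i → sylRow f d i c ≡ 0ℤ
sylRow-< f d i c c<i = cong (λ b → if b ∧ ((c ∸ i) ≤ᵇ d) then coeff f (d ∸ (c ∸ i)) else 0ℤ) (≤ᵇ-false c<i)

sylRow-band : ∀ f d i t → t ≤ℕ d → sylRow f d i (i ℕ.+ t) ≡ coeff f (d ∸ t)
sylRow-band f d i t t≤d = begin
  sylRow f d i (i ℕ.+ t)
    ≡⟨ cong (λ k → if (i ≤ᵇ i ℕ.+ t) ∧ (k ≤ᵇ d) then coeff f (d ∸ k) else 0ℤ) (ℕP.m+n∸m≡n i t) ⟩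
  (if (i ≤ᵇ i ℕ.+ t) ∧ (t ≤ᵇ d) then coeff f (d ∸ t) else 0ℤ)
    ≡⟨ cong₂ (λ b b′ → if b ∧ b′ then coeff f (d ∸ t) else 0ℤ) (≤ᵇ-true (ℕP.m≤m+n i t)) (≤ᵇ-true t≤d) ⟩
  coeff f (d ∸ t)
    ∎
  where open ≡-Reasoning

sylRow-> : ∀ f d i u → sylRow f d i (i ℕ.+ suc (d ℕ.+ u)) ≡ 0ℤ
sylRow-> f d i u = begin
  sylRow f d i (i ℕ.+ suc (d ℕ.+ u))
    ≡⟨ cong (λ k → if (i ≤ᵇ i ℕ.+ suc (d ℕ.+ u)) ∧ (k ≤ᵇ d) then coeff f (d ∸ k) else 0ℤ)
            (ℕP.m+n∸m≡n i (suc (d ℕ.+ u))) ⟩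
  (if (i ≤ᵇ i ℕ.+ suc (d ℕ.+ u)) ∧ (suc (d ℕ.+ u) ≤ᵇ d) then coeff f (d ∸ suc (d ℕ.+ u)) else 0ℤ)
    ≡⟨ cong (λ b → if (i ≤ᵇ i ℕ.+ suc (d ℕ.+ u)) ∧ b then coeff f (d ∸ suc (d ℕ.+ u)) else 0ℤ)
            (≤ᵇ-false (s≤s (ℕP.m≤m+n d u))) ⟩
  (if (i ≤ᵇ i ℕ.+ suc (d ℕ.+ u)) ∧ false then coeff f (d ∸ suc (d ℕ.+ u)) else 0ℤ)
    ≡⟨ cong (λ b → if b ∧ false then coeff f (d ∸ suc (d ℕ.+ u)) else 0ℤ)
            (≤ᵇ-true (ℕP.m≤m+n i (suc (d ℕ.+ u)))) ⟩
  0ℤ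
    ∎
  where open ≡-Reasoning

∑-band : ∀ i d e (F : ℕ → ℤ) → (∀ c → c <ℕ i → F c ≡ 0ℤ) → (∀ u → F (i ℕ.+ suc (d ℕ.+ u)) ≡ 0ℤ) →
         ∑ (suc (i ℕ.+ d ℕ.+ e)) F ≡ ∑ (suc d) (λ t → F (i ℕ.+ t))
∑-band i d e F below above = begin
  ∑ (suc (i ℕ.+ d ℕ.+ e)) F
    ≡⟨ cong (λ n → ∑ n F) (trans (cong suc (ℕP.+-assoc i d e)) (sym (ℕP.+-suc i (d ℕ.+ e)))) ⟩
  ∑ (i ℕ.+ (suc d ℕ.+ e)) F
    ≡⟨ ∑-split i (suc d ℕ.+ e) F ⟩
  ∑ i F + ∑ (suc d ℕ.+ e) (λ j → F (i ℕ.+ j))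
    ≡⟨ cong₂ _+_ (∑-zero i F below) (∑-split (suc d) e (λ j → F (i ℕ.+ j))) ⟩
  0ℤ + (∑ (suc d) (λ t → F (i ℕ.+ t)) + ∑ e (λ u → F (i ℕ.+ suc (d ℕ.+ u))))
    ≡⟨ cong (λ s → 0ℤ + (∑ (suc d) (λ t → F (i ℕ.+ t)) + s)) (∑-zero e _ (λ u _ → above u)) ⟩
  0ℤ + (∑ (suc d) (λ t → F (i ℕ.+ t)) + 0ℤ)
    ≡⟨ trans (ℤP.+-identityˡ _) (ℤP.+-identityʳ _) ⟩
  ∑ (suc d) (λ t → F (i ℕ.+ t))
    ∎
  where open ≡-Reasoning

sylRow-weighted-∑ : ∀ f d i K a → i ℕ.+ d ≤ℕ K →
  ∑ (suc K) (λ c → a ^ (K ∸ c) * sylRow f d i c) ≡ a ^ (K ∸ (i ℕ.+ d)) * ∑ (suc d) (λ t → coeff f t * a ^ t)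
sylRow-weighted-∑ f d i K a i+d≤K rewrite sym (ℕP.m+[n∸m]≡n i+d≤K) = begin
  ∑ (suc K′) F
    ≡⟨ ∑-band i d e F (λ c c<i → trans (cong (_*_ (a ^ (K′ ∸ c))) (sylRow-< f d i c c<i))
                                        (ℤP.*-zeroʳ (a ^ (K′ ∸ c))))
                      (λ u → trans (cong (_*_ (a ^ (K′ ∸ (i ℕ.+ suc (d ℕ.+ u))))) (sylRow-> f d i u))
                                  (ℤP.*-zeroʳ (a ^ (K′ ∸ (i ℕ.+ suc (d ℕ.+ u)))))) ⟩
  ∑ (suc d) (λ t → F (i ℕ.+ t))
    ≡⟨ ∑-cong (suc d) band-term ⟩
  ∑ (suc d) (λ t → a ^ e * (coeff f (d ∸ t) * a ^ (d ∸ t)))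
    ≡⟨ *-distribˡ-∑ (suc d) (a ^ e) (λ t → coeff f (d ∸ t) * a ^ (d ∸ t)) ⟩
  a ^ e * ∑ (suc d) (λ t → coeff f (d ∸ t) * a ^ (d ∸ t))
    ≡⟨ cong₂ _*_ (cong (a ^_) (sym (ℕP.m+n∸m≡n (i ℕ.+ d) e))) (∑-reverse d (λ t → coeff f t * a ^ t)) ⟩
  a ^ (K′ ∸ (i ℕ.+ d)) * ∑ (suc d) (λ t → coeff f t * a ^ t)
    ∎
  where
  open ≡-Reasoning
  e = K ∸ (i ℕ.+ d)
  K′ = i ℕ.+ d ℕ.+ e
  F : ℕ → ℤ
  F c = a ^ (K′ ∸ c) * sylRow f d i c
  regroup : ∀ x y c → x * y * c ≡ y * (c * x)
  regroup = solve-∀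
  band-term : ∀ t → t <ℕ suc d → F (i ℕ.+ t) ≡ a ^ e * (coeff f (d ∸ t) * a ^ (d ∸ t))
  band-term t (s≤s t≤d) = begin
    a ^ (K′ ∸ (i ℕ.+ t)) * sylRow f d i (i ℕ.+ t)
      ≡⟨ cong₂ _*_ (cong (a ^_) exponent) (sylRow-band f d i t t≤d) ⟩
    a ^ ((d ∸ t) ℕ.+ e) * coeff f (d ∸ t)
      ≡⟨ cong (_* coeff f (d ∸ t)) (ℤP.^-distribˡ-+-* a (d ∸ t) e) ⟩
    a ^ (d ∸ t) * a ^ e * coeff f (d ∸ t)
      ≡⟨ regroup (a ^ (d ∸ t)) (a ^ e) (coeff f (d ∸ t)) ⟩
    a ^ e * (coeff f (d ∸ t) * a ^ (d ∸ t))
      ∎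
    where
    exponent : K′ ∸ (i ℕ.+ t) ≡ (d ∸ t) ℕ.+ e
    exponent = trans (cong (_∸ (i ℕ.+ t)) (ℕP.+-assoc i d e))
                 (trans (ℕP.[m+n]∸[m+o]≡n∸o i (d ℕ.+ e) t) (ℕP.+-∸-comm e t≤d))

sylvesterℕ : (f g : Poly) (m n : ℕ) → Matrix
sylvesterℕ f g m n r c = if suc r ≤ᵇ n then sylRow f m r c else sylRow g n (r ∸ n) c

resultant≡detℕ : ∀ f g m n → resultant f g m n ≡ detℕ (m ℕ.+ n) (sylvesterℕ f g m n)
resultant≡detℕ f g m n = det≡detℕ (m ℕ.+ n) (sylvester f g m n) (sylvesterℕ f g m n) (λ _ _ → refl)

sylvesterℕ-top : ∀ f g m n r c → r <ℕ n → sylvesterℕ f g m n r c ≡ sylRow f m r c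
sylvesterℕ-top f g m n r c r<n = cong (λ b → if b then sylRow f m r c else sylRow g n (r ∸ n) c) (≤ᵇ-true r<n)

sylvesterℕ-bottom : ∀ f g m n r c → n ≤ℕ r → sylvesterℕ f g m n r c ≡ sylRow g n (r ∸ n) c
sylvesterℕ-bottom f g m n r c n≤r =
  cong (λ b → if b then sylRow f m r c else sylRow g n (r ∸ n) c) (≤ᵇ-false (s≤s n≤r))

module Congruence (p : ℤ) where

  infix 4 _≈_
  _≈_ : ℤ → ℤ → Set
  a ≈ b = p S.∣ a - b

  p∣0 : p S.∣ 0ℤ
  p∣0 = S.divides 0ℤ refl

  ≡0⇒p∣ : ∀ {x} → x ≡ 0ℤ → p S.∣ x
  ≡0⇒p∣ x≡0 = S.divides 0ℤ x≡0

  ∣-resp-≈ : ∀ {a b} → a ≈ b → p S.∣ b → p S.∣ a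
  ∣-resp-≈ {a} {b} a≈b p∣b = subst (p S.∣_) (cancel a b) (S.∣m∣n⇒∣m+n a≈b p∣b)
    where cancel : ∀ a b → a - b + b ≡ a
          cancel = solve-∀

  horner-cong : ∀ x a b e₁ e₂ → a ≈ b → e₁ ≈ e₂ → a + x * e₁ ≈ b + x * e₂
  horner-cong x a b e₁ e₂ a≈b e₁≈e₂ =
    subst (p S.∣_) (regroup x a b e₁ e₂) (S.∣m∣n⇒∣m+n a≈b (S.∣n⇒∣m*n x e₁≈e₂))
    where regroup : ∀ x a b e₁ e₂ → (a - b) + x * (e₁ - e₂) ≡ (a + x * e₁) - (b + x * e₂)
          regroup = solve-∀

  eval-cong-mod : ∀ f g x → (∀ i → coeff f i ≈ coeff g i) → eval f x ≈ eval g x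
  eval-cong-mod []      []      x f≈g = p∣0
  eval-cong-mod []      (b ∷ g) x f≈g =
    subst (_≈ b + x * eval g x) (trans (ℤP.+-identityˡ _) (ℤP.*-zeroʳ x))
          (horner-cong x 0ℤ b 0ℤ (eval g x) (f≈g 0) (eval-cong-mod [] g x (f≈g ∘ suc)))
  eval-cong-mod (a ∷ f) []      x f≈g =
    subst (a + x * eval f x ≈_) (trans (ℤP.+-identityˡ _) (ℤP.*-zeroʳ x))
          (horner-cong x a 0ℤ (eval f x) 0ℤ (f≈g 0) (eval-cong-mod f [] x (f≈g ∘ suc)))
  eval-cong-mod (a ∷ f) (b ∷ g) x f≈g =
    horner-cong x a b (eval f x) (eval g x) (f≈g 0) (eval-cong-mod f g x (f≈g ∘ suc))

  evalDeriv-cong-mod : ∀ f g x → (∀ i → coeff f i ≈ coeff g i) → evalDeriv f x ≈ evalDeriv g x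
  evalDeriv-cong-mod f g x f≈g = eval-cong-mod (deriv f) (deriv g) x λ i →
    subst (p S.∣_) (sym (trans (cong₂ _-_ (coeff-deriv f i) (coeff-deriv g i))
                               (distrib (+ suc i) (coeff f (suc i)) (coeff g (suc i)))))
          (S.∣n⇒∣m*n (+ suc i) (f≈g (suc i)))
    where distrib : ∀ c a b → c * a - c * b ≡ c * (a - b)
          distrib = solve-∀

  DegreeBelow : ℕ → Poly → Set
  DegreeBelow m f = ∀ i → m ≤ℕ i → p S.∣ coeff f i

  ∣coeffs⇒∣eval : ∀ f x → (∀ i → p S.∣ coeff f i) → p S.∣ eval f x
  ∣coeffs⇒∣eval []      x p∣f = p∣0
  ∣coeffs⇒∣eval (b ∷ f) x p∣f = S.∣m∣n⇒∣m+n (p∣f 0) (S.∣n⇒∣m*n x (∣coeffs⇒∣eval f x (p∣f ∘ suc)))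

  ∣eval⇒∣coeff₀ : ∀ f a → p S.∣ a → p S.∣ eval f a → p S.∣ coeff f 0
  ∣eval⇒∣coeff₀ []      a _   _   = p∣0
  ∣eval⇒∣coeff₀ (b ∷ f) a p∣a p∣e = S.∣m+n∣n⇒∣m p∣e (S.∣m⇒∣m*n (eval f a) p∣a)

  divByLinear-degree : ∀ a f m → DegreeBelow (suc m) f → DegreeBelow m (divByLinear a f)
  divByLinear-degree a []      m       p∣f i       _         = p∣0
  divByLinear-degree a (b ∷ f) zero    p∣f zero    _         = ∣coeffs⇒∣eval f a λ i → p∣f (suc i) (s≤s z≤n)
  divByLinear-degree a (b ∷ f) zero    p∣f (suc i) _         =
    divByLinear-degree a f zero (λ j _ → p∣f (suc j) (s≤s z≤n)) i z≤n
  divByLinear-degree a (b ∷ f) (suc m) p∣f (suc i) (s≤s m≤i) =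
    divByLinear-degree a f m (λ j m≤j → p∣f (suc j) (s≤s m≤j)) i m≤i

  ∣sylRow-weighted-∑ : ∀ f d i K a → i ℕ.+ d ≤ℕ K → length f ≡ suc d → p S.∣ eval f a →
                       p S.∣ ∑ (suc K) (λ c → a ^ (K ∸ c) * sylRow f d i c)
  ∣sylRow-weighted-∑ f d i K a i+d≤K len-f p∣fa =
    subst (p S.∣_) (sym (sylRow-weighted-∑ f d i K a i+d≤K)) (S.∣n⇒∣m*n (a ^ (K ∸ (i ℕ.+ d))) p∣∑)
    where p∣∑ = subst (p S.∣_) (trans (eval-as-∑ f a) (cong (λ n → ∑ n (λ t → coeff f t * a ^ t)) len-f)) p∣fa

  ∣sylRow-last : ∀ f d i K → i ℕ.+ d ≤ℕ K → p S.∣ coeff f 0 → p S.∣ sylRow f d i K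
  ∣sylRow-last f d i K i+d≤K p∣f₀ with (i ≤ᵇ K) ∧ ((K ∸ i) ≤ᵇ d)
  ... | false = p∣0
  ... | true  = subst (λ k → p S.∣ coeff f k) (sym (ℕP.m≤n⇒m∸n≡0 K∸i≤d)) p∣f₀
    where K∸i≤d = ℕP.m+n≤o⇒m≤o∸n d (subst (_≤ℕ K) (ℕP.+-comm i d) i+d≤K)

module PrimeModulus (P : ℕ) (P-prime : Prime P) where
  p : ℤ
  p = + P
  open Congruence p

  euclid : ∀ a b → p S.∣ a * b → p S.∣ a ⊎ p S.∣ b
  euclid a b p∣ab with euclidsLemma ∣ a ∣ ∣ b ∣ P-prime (subst (P ℕD.∣_) (ℤP.abs-* a b) (S.∣⇒∣ᵤ p∣ab))
  ... | inj₁ P∣a = inj₁ (S.∣ᵤ⇒∣ P∣a)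
  ... | inj₂ P∣b = inj₂ (S.∣ᵤ⇒∣ P∣b)

  ∣^*⇒∣ : ∀ k a d → ¬ (p S.∣ a) → p S.∣ a ^ k * d → p S.∣ d
  ∣^*⇒∣ zero    a d _   p∣d = subst (p S.∣_) (ℤP.*-identityˡ d) p∣d
  ∣^*⇒∣ (suc k) a d p∤a p∣aᵏ⁺¹d with euclid a (a ^ k * d) (subst (p S.∣_) (ℤP.*-assoc a (a ^ k) d) p∣aᵏ⁺¹d)
  ... | inj₁ p∣a   = ⊥-elim (p∤a p∣a)
  ... | inj₂ p∣aᵏd = ∣^*⇒∣ k a d p∤a p∣aᵏd

  DistinctMod : ∀ {k} → Vec ℤ k → Set
  DistinctMod []       = ⊤
  DistinctMod (r ∷ rs) = (∀ j → ¬ (p S.∣ lookup rs j - r)) × DistinctMod rs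

  SeparableMod : Poly → Set
  SeparableMod f = ∀ a → p S.∣ eval f a → p S.∣ evalDeriv f a → ⊥

  -- A repeated root rᵢ ≡ rⱼ (mod p) is a common root of the product and its derivative.
  separable⇒distinct : ∀ {k} (rs : Vec ℤ k) → SeparableMod (linProd rs) → DistinctMod rs
  separable⇒distinct []       sep = tt
  separable⇒distinct (r ∷ rs) sep = (λ j p∣s-r → sep (lookup rs j) (root j) (deriv-root j p∣s-r))
                                  , separable⇒distinct rs sep′
    where
    root : ∀ j → p S.∣ eval (linProd (r ∷ rs)) (lookup rs j)
    root j = ≡0⇒p∣ (eval-linProd-root (r ∷ rs) (fsuc j))
    deriv-root : ∀ j → p S.∣ lookup rs j - r → p S.∣ evalDeriv (linProd (r ∷ rs)) (lookup rs j)
    deriv-root j p∣s-r = subst (p S.∣_) (sym (evalDeriv-linProd-∷ r rs (lookup rs j)))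
      (S.∣m∣n⇒∣m+n (≡0⇒p∣ (eval-linProd-root rs j)) (S.∣m⇒∣m*n _ p∣s-r))
    sep′ : SeparableMod (linProd rs)
    sep′ a p∣e p∣d = sep a
      (subst (p S.∣_) (sym (eval-linProd-∷ r rs a)) (S.∣n⇒∣m*n (a - r) p∣e))
      (subst (p S.∣_) (sym (evalDeriv-linProd-∷ r rs a)) (S.∣m∣n⇒∣m+n p∣e (S.∣n⇒∣m*n (a - r) p∣d)))

  -- Over the field ℤ/p, a polynomial of degree < m with m distinct roots is zero:
  -- divide by x - r₀ and induct on the quotient, which has the remaining roots.
  roots⇒∣coeffs : ∀ m (rs : Vec ℤ m) f → DistinctMod rs → DegreeBelow m f →
                  (∀ j → p S.∣ eval f (lookup rs j)) → ∀ i → p S.∣ coeff f i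
  roots⇒∣coeffs zero    []       f _                   deg<0 _     i = deg<0 i z≤n
  roots⇒∣coeffs (suc m) (r ∷ rs) f (r≢rs , distinct) deg<m roots = p∣f
    where
    q = divByLinear r f
    roots-q : ∀ j → p S.∣ eval q (lookup rs j)
    roots-q j with euclid (lookup rs j - r) (eval q (lookup rs j))
      (S.∣m+n∣n⇒∣m (subst (p S.∣_) (eval-divByLinear r f (lookup rs j)) (roots (fsuc j))) (roots fzero))
    ... | inj₁ p∣s-r = ⊥-elim (r≢rs j p∣s-r)
    ... | inj₂ p∣q   = p∣q
    p∣q : ∀ i → p S.∣ coeff q i
    p∣q = roots⇒∣coeffs m rs q distinct (divByLinear-degree r f m deg<m) roots-q
    p∣f : ∀ i → p S.∣ coeff f i
    p∣f zero    = subst (p S.∣_) (sym (coeff-divByLinear-zero r f))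
                        (S.∣m∣n⇒∣m-n (roots fzero) (S.∣n⇒∣m*n r (p∣q 0)))
    p∣f (suc i) = subst (p S.∣_) (sym (coeff-divByLinear-suc r f i))
                        (S.∣m∣n⇒∣m-n (p∣q i) (S.∣n⇒∣m*n r (p∣q (suc i))))

  -- With the weights a ^ (K ∸ c), every row of the Sylvester matrix sums to a multiple of f(a)
  -- or g(a).  If p ∤ a this forces p ∣ det; if p ∣ a, the last column is divisible by p.
  resultant-common-root : ∀ f g m n K a → m ℕ.+ n ≡ suc K → length f ≡ suc m → length g ≡ suc n →
                          p S.∣ eval f a → p S.∣ eval g a → p S.∣ resultant f g m n
  resultant-common-root f g m n K a m+n≡1+K len-f len-g p∣fa p∣ga =
    subst (p S.∣_) (sym (trans (resultant≡detℕ f g m n) (cong (λ k → detℕ k Syl) m+n≡1+K))) p∣det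
    where
    Syl = sylvesterℕ f g m n

    GoodRow : (ℕ → ℤ) → Set
    GoodRow row = p S.∣ ∑ (suc K) (λ c → a ^ (K ∸ c) * row c) × (p S.∣ a → p S.∣ row K)

    GoodRow-cong : ∀ {row row′} → (∀ c → row c ≡ row′ c) → GoodRow row′ → GoodRow row
    GoodRow-cong row≡row′ (p∣∑ , p∣last) =
        subst (p S.∣_) (∑-cong′ (suc K) λ c → cong (_*_ (a ^ (K ∸ c))) (sym (row≡row′ c))) p∣∑
      , λ p∣a → subst (p S.∣_) (sym (row≡row′ K)) (p∣last p∣a)

    block-row : ∀ F d i → i ℕ.+ d ≤ℕ K → length F ≡ suc d → p S.∣ eval F a → GoodRow (sylRow F d i)
    block-row F d i fits len-F p∣Fa =
        ∣sylRow-weighted-∑ F d i K a fits len-F p∣Fa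
      , λ p∣a → ∣sylRow-last F d i K fits (∣eval⇒∣coeff₀ F a p∣a p∣Fa)

    good-row : ∀ r → r <ℕ suc K → GoodRow (Syl r)
    good-row r r≤K with r ℕ.<? n
    ... | yes r<n = GoodRow-cong (λ c → sylvesterℕ-top f g m n r c r<n) (block-row f m r fits len-f p∣fa)
      where fits = ℕP.≤-pred (subst (suc (r ℕ.+ m) ≤ℕ_) (trans (ℕP.+-comm n m) m+n≡1+K) (ℕP.+-monoˡ-≤ m r<n))
    ... | no  r≮n =
      GoodRow-cong (λ c → sylvesterℕ-bottom f g m n r c n≤r) (block-row g n (r ∸ n) fits len-g p∣ga)
      where n≤r  = ℕP.≮⇒≥ r≮n
            fits = subst (_≤ℕ K) (sym (ℕP.m∸n+n≡m n≤r)) (ℕP.≤-pred r≤K)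

    p∣det : p S.∣ detℕ (suc K) Syl
    p∣det with p S.∣? a
    ... | yes p∣a = ∣column⇒∣detℕ (suc K) Syl K (ℕP.n<1+n K) (λ r r≤K → proj₂ (good-row r r≤K) p∣a)
    ... | no  p∤a = ∣^*⇒∣ K a (detℕ (suc K) Syl) p∤a
                      (∣rows⇒∣*detℕ K Syl (λ c → a ^ (K ∸ c)) (λ r r≤K → proj₁ (good-row r r≤K)))

  disc-common-root : ∀ h a → Monic h → p S.∣ eval h a → p S.∣ evalDeriv h a → p S.∣ disc h
  disc-common-root h a ([] , refl) p∣h₁ _ = ⊥-elim (¬prime[1] (subst Prime P≡1 P-prime))
    where h₁≡1 = trans (cong (_+_ 1ℤ) (ℤP.*-zeroʳ a)) (ℤP.+-identityʳ 1ℤ)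
          P≡1  = ℕD.∣1⇒≡1 (S.∣⇒∣ᵤ (subst (p S.∣_) h₁≡1 p∣h₁))
  disc-common-root h a ((c ∷ cs) , refl) p∣ha p∣h′a =
    S.∣n⇒∣m*n (-1ℤ ^ ((deg h ℕ.* (deg h ∸ 1)) ℕ./ 2))
      (subst (λ d → p S.∣ resultant h (deriv h) d (d ∸ 1)) (sym length-cs+1)
        (resultant-common-root h (deriv h) (suc m) m (m ℕ.+ m) a refl
           (cong suc length-cs+1) (trans (length-derivFrom 1 (cs ++ + 1 ∷ [])) length-cs+1) p∣ha p∣h′a))
    where
    m = length cs
    length-cs+1 : length (cs ++ + 1 ∷ []) ≡ suc m
    length-cs+1 = trans (length-++ cs) (ℕP.+-comm m 1)

  remainder-vanishes : ∀ h g q R → Monic h → ¬ (p S.∣ disc h) → SplitsMod h P →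
    (∀ k → p ∣ eval h k → p ∣ eval g k) →
    (∀ i → coeff g i ≡ coeff (h *ₚ q) i + coeff R i) → (∀ i → deg h ≤ℕ i → coeff R i ≡ 0ℤ) →
    ∀ i → p S.∣ coeff R i
  remainder-vanishes h g q R monic p∤disc (rs , h≡∏) h-root⇒g-root g≡hq+R deg-R =
    roots⇒∣coeffs (deg h) rs R (separable⇒distinct rs separable)
      (λ i deg≤i → ≡0⇒p∣ (deg-R i deg≤i)) R-root
    where
    h≈∏ : ∀ i → coeff h i ≈ coeff (linProd rs) i
    h≈∏ i = S.∣ᵤ⇒∣ (h≡∏ i)
    separable : SeparableMod (linProd rs)
    separable a p∣∏a p∣∏′a = p∤disc (disc-common-root h a monic
      (∣-resp-≈ (eval-cong-mod h (linProd rs) a h≈∏) p∣∏a)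
      (∣-resp-≈ (evalDeriv-cong-mod h (linProd rs) a h≈∏) p∣∏′a))
    R-root : ∀ j → p S.∣ eval R (lookup rs j)
    R-root j = S.∣m+n∣m⇒∣n (subst (p S.∣_) (eval-division g h q R r g≡hq+R) p∣gr) (S.∣m⇒∣m*n (eval q r) p∣hr)
      where
      r = lookup rs j
      p∣hr : p S.∣ eval h r
      p∣hr = ∣-resp-≈ (eval-cong-mod h (linProd rs) r h≈∏) (≡0⇒p∣ (eval-linProd-root rs j))
      p∣gr : p S.∣ eval g r
      p∣gr = S.∣ᵤ⇒∣ (h-root⇒g-root r (S.∣⇒∣ᵤ p∣hr))

∣-small⇒≡0 : ∀ P x → ∣ x ∣ <ℕ P → + P S.∣ x → x ≡ 0ℤ
∣-small⇒≡0 P x ∣x∣<P P∣x with ∣ x ∣ in ∣x∣≡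
... | zero  = ℤP.∣i∣≡0⇒i≡0 ∣x∣≡
... | suc k = ⊥-elim (ℕD.>⇒∤ ∣x∣<P (subst (P ℕD.∣_) ∣x∣≡ (S.∣⇒∣ᵤ P∣x)))

Monic⇒length : ∀ h → Monic h → length h ≡ suc (deg h)
Monic⇒length h (cs , refl) rewrite length-++ cs {+ 1 ∷ []} | ℕP.+-comm (length cs) 1 = refl

Monic⇒leading : ∀ h → Monic h → coeff h (deg h) ≡ 1ℤ
Monic⇒leading h (cs , refl) rewrite length-++ cs {+ 1 ∷ []} | ℕP.+-comm (length cs) 1 = top cs
  where top : ∀ cs → coeff (cs ++ + 1 ∷ []) (length cs) ≡ 1ℤ
        top []       = refl
        top (c ∷ cs) = top cs

lemma3p2 : (g h : Poly) → Monic g → Monic h → disc h ≢ + 0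
           → (∀ (N : ℕ) → ∃[ p ] (p > N × Prime p × SplitsMod h p
                 × (∀ (k : ℤ) → (+ p) ∣ eval h k → (+ p) ∣ eval g k)))
           → h ∣ₚ g
lemma3p2 g h _ monic-h disc≢0 large-primes
  with divMonic h (deg h) (Monic⇒leading h monic-h) (Monic⇒length h monic-h) g
... | q , R , g≡hq+R , deg-R =
  q , λ i → trans (g≡hq+R i) (trans (cong (_+_ (coeff (h *ₚ q) i)) (R≡0 i)) (ℤP.+-identityʳ _))
  where
  R≡0 : ∀ i → coeff R i ≡ 0ℤ
  R≡0 i with large-primes (∣ disc h ∣ ⊔ ∣ coeff R i ∣)
  ... | P , P> , P-prime , splits , h-root⇒g-root =
    ∣-small⇒≡0 P (coeff R i) (ℕP.≤-<-trans (ℕP.m≤n⊔m _ _) P>)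
      (PrimeModulus.remainder-vanishes P P-prime h g q R monic-h P∤disc splits h-root⇒g-root
         g≡hq+R deg-R i)
    where
    P∤disc : ¬ (+ P S.∣ disc h)
    P∤disc P∣disc = disc≢0 (∣-small⇒≡0 P (disc h) (ℕP.≤-<-trans (ℕP.m≤m⊔n _ _) P>) P∣disc)
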